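{- Let $P$ be a Dedalus program, $H$ an input distributed database instance for $P$ over network $N$, and $\mathcal R$ a fair run of $P$ on input $H$. For all $(x,s),(y,t)\in N\times\mathbb{N}$, if $(x,s)\prec(y,t)$ then $\mathrm{glob}(x,s)<\mathrm{glob}(y,t)$.
   Context: **Dedalus programs.** A Dedalus program $P$ is a finite set of constant-free safe Datalog-with-negation rules of three kinds: deductive rules (ordinary rules); inductive rules $R(\bar u)\bullet\leftarrow B$; asynchronous rules $R(\bar u)\mid y\leftarrow B$ with $y$ a variable of the body; the deductive rules are syntactically stratifiable. $\mathrm{idb}(P)$ are relations occurring in heads, $\mathrm{edb}(P)$ the others. A network is a nonempty finite set $N$ of nodes; an input is a map $H$ assigning each $x\in N$ a finite instance over $\mathrm{edb}(P)$. **Operational semantics.** $\mathrm{deduc}(P)$ (deductive rules, stratified semantics), $\mathrm{induc}(P)$ (inductive rules with $\bullet$ removed) and $\mathrm{async}(P)$ (each $R(\bar u)\mid y\leftarrow B$ replaced by $R(y,\bar u)\leftarrow B$); the latter two are evaluated in a single step (facts derived by all satisfying valuations, no fixpoint). A configuration is $(st,bf)$: $st(x)$ an instance, $bf(x)$ a set of pairs $(i,f)$, $i\in\mathbb N$, $f$ a fact over $\mathrm{idb}(P)$. Start configuration: $st(x)=H(x)$, $bf(x)=\emptyset$. A transition with send-tag $i$ is $(\rho_a,x,m,i,\rho_b)$, $m\subseteq bf_a(x)$, where with $I=st_a(x)\cup\{f\mid\exists j:(j,f)\in m\}$, $D=\mathrm{deduc}(P)(I)$, $\delta_y=\{(i,R(\bar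 a))\mid R(y,\bar a)\in\mathrm{async}(P)(D)\}$: $st_b(x)=H(x)\cup\mathrm{induc}(P)(D)$, $bf_b(x)=(bf_a(x)\setminus m)\cup\delta_x$, and for $y\ne x$, $st_b(y)=st_a(y)$, $bf_b(y)=bf_a(y)\cup\delta_y$. We say the pairs in $m$ are delivered to $x$ in this transition and that $x$ sends $R(\bar a)$ to $y$ when $(i,R(\bar a))\in\delta_y$. A run is an infinite sequence of transitions indexed from $0$, starting at the start configuration, consecutive ones chained, transition $i$ using send-tag $i$. It is fair if each node is active infinitely often and every pair $(j,f)$ in a buffer $bf(y)$ of some configuration is eventually delivered to $y$. **Timestamps and happens-before.** $\mathrm{loc}(i)$ is the number of transitions before $i$ with the same active node; $\mathrm{glob}(x,s)$ is the unique transition $i$ with active node $x$ and $\mathrm{loc}(i)=s$. Let $\mathrm{mesg}(\mathcal R)$ be the set of tuples $(x,s,y,t,f)$ such that in transition $i=\mathrm{glob}(x,s)$ node $x$ sends $f$ to $y$ and the pair $(i,f)$ is delivered to $y$ in transition $\mathrm{glob}(y,t)$. The happens-before relation $\prec$ is the smallest relation on $N\times\mathbb N$ such that $(x,s)\prec(x,s+1)$ for all $(x,s)$; $(x,s)\prec(y,t)$ whenever $(x,s,y,t,f)\in\mathrm{mesg}(\mathcal R)$ for some $f$; and $\prec$ is transitive. -}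

module Defs where

open import Data.Nat using (ℕ; zero; suc; _+_; _≤_; _<_)
open import Data.Nat.Properties using (_≟_)
open import Data.Vec using (Vec; toList) renaming (map to vmap)
open import Data.List using (List; []; _∷_; _++_; concatMap)
open import Data.List.Membership.Propositional using (_∈_)
open import Data.List.Relation.Unary.All using (All)
open import Data.Product using (Σ; ∃; _×_; _,_; proj₁; proj₂)
open import Data.Sum using (_⊎_)
open import Relation.Nullary using (¬_; yes; no)
open import Relation.Binary.PropositionalEquality using (_≡_; _≢_)
open import Function.Bundles using (_⇔_)

Val : Set
Val = ℕ

Var : Set
Var = ℕ

record RelSym : Set where
  constructor rel
  field
    name  : ℕ
    arity : ℕ
open RelSym public

Fact : Set
Fact = Σ RelSym (λ R → Vec Val (arity R))

Atom : Set
Atom = Σ RelSym (λ R → Vec Var (arity R))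

atomVars : Atom → List Var
atomVars (R , us) = toList us

inst : (Var → Val) → Atom → Fact
inst v (R , us) = R , vmap v us

data Kind : Set where
  ded  : Kind
  ind  : Kind            -- R(ū)• ← B
  asy        : Var → Kind      -- R(ū) | y ← B

record Rule : Set where
  field
    head : Atom
    pos  : List Atom
    neg  : List Atom
    kind : Kind
open Rule public

headRel : Rule → RelSym
headRel r = proj₁ (head r)

posVars : Rule → List Var
posVars r = concatMap atomVars (pos r)

boundVars : Rule → List Var
boundVars r = atomVars (head r) ++ concatMap atomVars (neg r) ++ kv (kind r)
  where
    kv : Kind → List Var
    kv (asy y) = y ∷ []
    kv _         = []

Safe : Rule → Set
Safe r = ∀ u → u ∈ boundVars r → u ∈ posVars r

IsStratification : List Rule → (RelSym → ℕ) → Set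
IsStratification rs σ =
  ∀ r → r ∈ rs → kind r ≡ ded →
    All (λ a → σ (proj₁ a) ≤ σ (headRel r)) (pos r) ×
    All (λ a → σ (proj₁ a) < σ (headRel r)) (neg r)

record Program : Set where
  field
    rules      : List Rule
    safe       : All Safe rules
    strat      : RelSym → ℕ
    stratified : IsStratification rules strat
open Program public

IsEdb : Program → RelSym → Set
IsEdb P R = All (λ r → headRel r ≢ R) (rules P)

Inst : Set₁
Inst = Fact → Set

SatBody : Inst → Rule → (Var → Val) → Set
SatBody D r v = All (λ a → D (inst v a)) (pos r) × All (λ a → ¬ D (inst v a)) (neg r)

-- Der P Low k: least fixpoint of the deductive rules whose head is at
-- stratum k, on top of Low (everything computed at lower strata);
-- negation is evaluated against Low.
data Der (P : Program) (Low : Inst) (k : ℕ) : Fact → Set where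
  base : ∀ {f} → Low f → Der P Low k f
  app  : (r : Rule) → r ∈ rules P → kind r ≡ ded →
         strat P (headRel r) ≡ k → (v : Var → Val) →
         All (λ a → Der P Low k (inst v a)) (pos r) →
         All (λ a → ¬ Low (inst v a)) (neg r) →
         Der P Low k (inst v (head r))

Stratum : Program → Inst → ℕ → Inst
Stratum P I zero    = Der P I zero
Stratum P I (suc k) = Der P (Stratum P I k) (suc k)

deduc : Program → Inst → Inst
deduc P I f = ∃ λ k → Stratum P I k f

-- induc(P)(D): single step of the inductive rules (• removed).
induc : Program → Inst → Inst
induc P D f = ∃ λ r → r ∈ rules P × kind r ≡ ind ×
  Σ (Var → Val) (λ v → SatBody D r v × f ≡ inst v (head r))

-- async(P)(D) restricted to location y: R(y,ā) ∈ async(P)(D) iff AsyncOut P D y R(ā).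
AsyncOut : Program → Inst → Val → Fact → Set
AsyncOut P D y f = ∃ λ r → r ∈ rules P × ∃ λ z → kind r ≡ asy z ×
  Σ (Var → Val) (λ v → SatBody D r v × v z ≡ y × f ≡ inst v (head r))

record Network : Set where
  field
    nodes    : List Val
    nonempty : ∃ λ x → x ∈ nodes
open Network public

record Input (P : Program) (N : Network) : Set where
  field
    H     : Val → List Fact
    isEdb : ∀ x → x ∈ nodes N → All (λ f → IsEdb P (proj₁ f)) (H x)
open Input public

-- Buffers: sets of pairs (i , f).
Buf : Set₁
Buf = ℕ → Fact → Set

record Config : Set₁ where
  field
    st : Val → Inst
    bf : Val → Buf
open Config public

IsStart : (P : Program) (N : Network) → Input P N → Config → Set
IsStart P N inp c = ∀ x → x ∈ nodes N →
  (∀ f → st c x f ⇔ f ∈ H inp x) × (∀ j f → ¬ bf c x j f)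

Dof : Program → Config → Val → Buf → Inst
Dof P c x m = deduc P (λ f → st c x f ⊎ ∃ λ j → m j f)

record Step (P : Program) (N : Network) (inp : Input P N)
            (a : Config) (x : Val) (m : Buf) (i : ℕ) (b : Config) : Set where
  field
    active   : x ∈ nodes N
    m⊆bf     : ∀ j f → m j f → bf a x j f
    st-x     : ∀ f → st b x f ⇔ (f ∈ H inp x ⊎ induc P (Dof P a x m) f)
    bf-x     : ∀ j f → bf b x j f ⇔
                 ((bf a x j f × ¬ m j f) ⊎ (j ≡ i × AsyncOut P (Dof P a x m) x f))
    st-other : ∀ y → y ∈ nodes N → y ≢ x → ∀ f → st b y f ⇔ st a y f
    bf-other : ∀ y → y ∈ nodes N → y ≢ x → ∀ j f → bf b y j f ⇔
                 (bf a y j f ⊎ (j ≡ i × AsyncOut P (Dof P a x m) y f))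

record Run (P : Program) (N : Network) (inp : Input P N) : Set₁ where
  field
    conf  : ℕ → Config
    node  : ℕ → Val
    msg   : ℕ → Buf
    start : IsStart P N inp (conf 0)
    step  : ∀ i → Step P N inp (conf i) (node i) (msg i) i (conf (suc i))
open Run public

module _ {P : Program} {N : Network} {inp : Input P N} (R : Run P N inp) where

  Fair : Set
  Fair = (∀ x → x ∈ nodes N → ∀ n → ∃ λ i → n ≤ i × node R i ≡ x)
       × (∀ k y j f → y ∈ nodes N → bf (conf R k) y j f →
            ∃ λ i → k ≤ i × node R i ≡ y × msg R i j f)

  count : Val → ℕ → ℕ
  count x zero = zero
  count x (suc n) with node R n ≟ x
  ... | yes _ = suc (count x n)
  ... | no  _ = count x n

  loc : ℕ → ℕ
  loc i = count (node R i) i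

  IsGlob : Val → ℕ → ℕ → Set
  IsGlob x s i = node R i ≡ x × loc i ≡ s

  Sends : ℕ → Val → Fact → Set
  Sends i y f = AsyncOut P (Dof P (conf R i) (node R i) (msg R i)) y f

  Mesg : Val → ℕ → Val → ℕ → Fact → Set
  Mesg x s y t f = ∃ λ i → ∃ λ j → IsGlob x s i × IsGlob y t j ×
                   Sends i y f × msg R j i f

  data _≺_ : Val × ℕ → Val × ℕ → Set where
    local : ∀ x s → x ∈ nodes N → (x , s) ≺ (x , suc s)
    mesg  : ∀ x s y t f → Mesg x s y t f → (x , s) ≺ (y , t)
    trans : ∀ {p q r} → p ≺ q → q ≺ r → p ≺ r

module Submission where

open import Defs
open import Data.Nat using (ℕ; zero; suc; _≤_; _<_; _≤′_; ≤′-refl; ≤′-step)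
open import Data.Nat.Properties
  using (_≟_; ≤-refl; ≤-trans; ≤-antisym; n≤1+n; m≤n⇒m≤1+n; n<1+n; <-trans; ≤⇒≤′; suc-injective; ≰⇒>; ≮⇒≥; <⇒≱)
open import Data.Product using (∃; _×_; _,_; proj₂)
open import Data.Sum using (inj₁; inj₂)
open import Data.Empty using (⊥-elim)
open import Data.List.Membership.Propositional using (_∈_)
open import Relation.Nullary using (yes; no)
open import Relation.Binary.PropositionalEquality using (_≡_; refl; subst; subst₂)
open import Function.Bundles using (Equivalence)

-- Buffers only ever hold pairs tagged by earlier transitions, so a message is
-- delivered strictly after the transition that sent it; and the local
-- counter of a node is monotone, so the s-th step of x precedes its
-- (s+1)-th.  Transitivity then only needs a glob for the middle point of a
-- chain, and such globs propagate backwards along ≺ (if x took s+1 steps it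
-- took s).

module _ {P : Program} {N : Network} {inp : Input P N} (R : Run P N inp) where

  count-suc-active : ∀ {x i} → node R i ≡ x → count R x (suc i) ≡ suc (count R x i)
  count-suc-active {x} {i} e with node R i ≟ x
  ... | yes _ = refl
  ... | no ne = ⊥-elim (ne e)

  count-≤-suc : ∀ x i → count R x i ≤ count R x (suc i)
  count-≤-suc x i with node R i ≟ x
  ... | yes _ = n≤1+n _
  ... | no _ = ≤-refl

  count-mono′ : ∀ {x i k} → i ≤′ k → count R x i ≤ count R x k
  count-mono′ ≤′-refl = ≤-refl
  count-mono′ {x} (≤′-step {k} i≤′k) = ≤-trans (count-mono′ i≤′k) (count-≤-suc x k)

  count-mono : ∀ {x i k} → i ≤ k → count R x i ≤ count R x k
  count-mono i≤k = count-mono′ (≤⇒≤′ i≤k)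

  count-strict : ∀ {x i k} → node R i ≡ x → i < k → count R x i < count R x k
  count-strict e i<k = subst (_≤ _) (count-suc-active e) (count-mono i<k)

  count-pred : ∀ {x s} j → count R x j ≡ suc s → ∃ λ k → node R k ≡ x × count R x k ≡ s
  count-pred zero ()
  count-pred {x} (suc j) c with node R j ≟ x
  ... | yes e = j , e , suc-injective c
  ... | no _ = count-pred j c

  glob-count : ∀ {x s i} → IsGlob R x s i → count R x i ≡ s
  glob-count (refl , l) = l

  glob-monotone : ∀ {x s s′ i j} → IsGlob R x s i → IsGlob R x s′ j → s ≤ s′ → i ≤ j
  glob-monotone gi gj@(e , _) s≤s′ = ≮⇒≥ λ j<i →
    <⇒≱ (subst₂ _<_ (glob-count gj) (glob-count gi) (count-strict e j<i)) s≤s′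

  glob-unique : ∀ {x s i j} → IsGlob R x s i → IsGlob R x s j → i ≡ j
  glob-unique gi gj = ≤-antisym (glob-monotone gi gj ≤-refl) (glob-monotone gj gi ≤-refl)

  glob-strict : ∀ {x s s′ i j} → IsGlob R x s i → IsGlob R x s′ j → s < s′ → i < j
  glob-strict gi gj s<s′ = ≰⇒> λ j≤i →
    <⇒≱ s<s′ (subst₂ _≤_ (glob-count gj) (glob-count gi) (count-mono j≤i))

  glob-pred : ∀ {x s j} → IsGlob R x (suc s) j → ∃ (IsGlob R x s)
  glob-pred {j = j} gj with count-pred j (glob-count gj)
  ... | k , refl , c = k , refl , c

  buffered-tag< : ∀ k {y} → y ∈ nodes N → ∀ {j f} → bf (conf R k) y j f → j < k
  buffered-tag< zero y∈ {j} {f} b = ⊥-elim (proj₂ (start R _ y∈) j f b)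
  buffered-tag< (suc k) {y} y∈ {j} {f} b with y ≟ node R k
  ... | yes refl with Equivalence.to (Step.bf-x (step R k) j f) b
  ...   | inj₁ (b′ , _) = m≤n⇒m≤1+n (buffered-tag< k y∈ b′)
  ...   | inj₂ (refl , _) = n<1+n k
  buffered-tag< (suc k) y∈ {j} {f} b | no y≢x
    with Equivalence.to (Step.bf-other (step R k) _ y∈ y≢x j f) b
  ... | inj₁ b′ = m≤n⇒m≤1+n (buffered-tag< k y∈ b′)
  ... | inj₂ (refl , _) = n<1+n k

  delivered-tag< : ∀ {i j f} → msg R j i f → i < j
  delivered-tag< {i} {j} {f} m =
    buffered-tag< j (Step.active (step R j)) (Step.m⊆bf (step R j) i f m)

  ≺-glob-backward : ∀ {x s y t} → _≺_ R (x , s) (y , t) → ∃ (IsGlob R y t) → ∃ (IsGlob R x s)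
  ≺-glob-backward (local x s _) (_ , gj) = glob-pred gj
  ≺-glob-backward (mesg x s y t f (i , _ , gi , _)) _ = i , gi
  ≺-glob-backward (trans {q = _ , _} p≺q q≺r) g = ≺-glob-backward p≺q (≺-glob-backward q≺r g)

  ≺⇒glob< : ∀ {x s y t} → _≺_ R (x , s) (y , t) →
            ∀ {i j} → IsGlob R x s i → IsGlob R y t j → i < j
  ≺⇒glob< (local x s _) gi gj = glob-strict gi gj (n<1+n s)
  ≺⇒glob< (mesg x s y t f (i′ , j′ , gi′ , gj′ , _ , delivered)) gi gj
    rewrite glob-unique gi gi′ | glob-unique gj gj′ = delivered-tag< delivered
  ≺⇒glob< (trans {q = _ , _} p≺q q≺r) gi gj with ≺-glob-backward q≺r (_ , gj)
  ... | k , gk = <-trans (≺⇒glob< p≺q gi gk) (≺⇒glob< q≺r gk gj)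

lemma2 : (P : Program) (N : Network) (inp : Input P N) (R : Run P N inp) →
    Fair R → ∀ (x : Val) (s : ℕ) (y : Val) (t : ℕ) →
    _≺_ R (x , s) (y , t) →
    ∀ (i j : ℕ) → IsGlob R x s i → IsGlob R y t j → i < j
lemma2 P N inp R _ x s y t x≺y i j gi gj = ≺⇒glob< R x≺y gi gj
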